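{- Let $G$ be a cubic graph with a cycle-separating $4$-edge-cut $S$ whose removal leaves components $G_1$ and $G_2$. If both $G_1$ and $G_2$ are $3$-edge-colourable, then $\omega(G)\le 2$.
   Context: An edge-cut $S$ of a connected graph $G$ is cycle-separating if at least two components of $G-S$ contain cycles. The oddness $\omega(G)$ of a cubic graph $G$ is the smallest number of odd circuits in a $2$-factor of $G$ (it is $0$ exactly when $G$ is $3$-edge-colourable). -}

module Defs where

open import Data.Nat using (ℕ; zero; suc; _+_; _≤_; _%_)
open import Data.Nat.DivMod using (m%n<n)
open import Data.Fin using (Fin; toℕ; fromℕ<) renaming (_≟_ to _≟ᶠ_)
open import Data.Bool using (Bool; true; false; if_then_else_; _xor_)
open import Data.List using (List; map; allFin)
open import Data.Nat.ListAction using (sum)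
open import Data.Product using (Σ; _×_; _,_; ∃)
open import Data.Sum using (_⊎_)
open import Relation.Nullary using (¬_; does)
open import Relation.Binary.PropositionalEquality using (_≡_)
open import Function.Definitions using (Injective)

-- A finite multigraph (parallel edges and loops allowed): vertices Fin n,
-- edges Fin m, each edge has two ends (half-edges) ends e 0, ends e 1.
record Graph : Set where
  field
    n    : ℕ
    m    : ℕ
    ends : Fin m → Fin 2 → Fin n
open Graph public

Σ[_] : (k : ℕ) → (Fin k → ℕ) → ℕ
Σ[ k ] f = sum (map f (allFin k))

[_≟_] : {k : ℕ} → Fin k → Fin k → ℕ
[ x ≟ y ] = if does (x ≟ᶠ y) then 1 else 0

⟦_⟧ : Bool → ℕ
⟦ b ⟧ = if b then 1 else 0

module _ (G : Graph) where

  degIn : (Fin (m G) → Bool) → Fin (n G) → ℕ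
  degIn F v = Σ[ m G ] (λ e → ⟦ F e ⟧ * ([ ends G e Fin.zero ≟ v ] + [ ends G e (Fin.suc Fin.zero) ≟ v ]))
    where open import Data.Nat using (_*_)
          import Data.Fin as Fin

  -- degree (a loop counts twice)
  deg : Fin (n G) → ℕ
  deg = degIn (λ _ → true)

  Cubic : Set
  Cubic = ∀ v → deg v ≡ 3

  Joins : Fin (m G) → Fin (n G) → Fin (n G) → Set
  Joins e u w = (ends G e Fin.zero ≡ u × ends G e (Fin.suc Fin.zero) ≡ w)
              ⊎ (ends G e Fin.zero ≡ w × ends G e (Fin.suc Fin.zero) ≡ u)
    where import Data.Fin as Fin

  next : {k : ℕ} → Fin (suc k) → Fin (suc k)
  next {k} i = fromℕ< (m%n<n (suc (toℕ i)) (suc k))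

  -- A circuit (cycle) of length suc len: distinct vertices vs 0 .. vs len,
  -- distinct edges es i joining vs i and vs (i+1 mod (suc len)).
  -- Length 1 = loop, length 2 = pair of parallel edges.
  record Circuit : Set where
    field
      len    : ℕ
      vs     : Fin (suc len) → Fin (n G)
      es     : Fin (suc len) → Fin (m G)
      vs-inj : Injective _≡_ _≡_ vs
      es-inj : Injective _≡_ _≡_ es
      joins  : ∀ i → Joins (es i) (vs i) (vs (next i))
  open Circuit public

  oddC : Circuit → ℕ
  oddC c = suc (len c) % 2

  occ : Circuit → Fin (m G) → ℕ
  occ c e = Σ[ suc (len c) ] (λ i → [ es c i ≟ e ])

  TwoFactor : (Fin (m G) → Bool) → Set
  TwoFactor F = ∀ v → degIn F v ≡ 2

  CircuitsOf : (Fin (m G) → Bool) → List Circuit → Set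
  CircuitsOf F cs = ∀ e → sum (map (λ c → occ c e) cs) ≡ ⟦ F e ⟧

  OddnessAtMost : ℕ → Set
  OddnessAtMost k = Σ (Fin (m G) → Bool) λ F → TwoFactor F ×
                      Σ (List Circuit) λ cs → CircuitsOf F cs × sum (map oddC cs) ≤ k

  Inside : (Fin (n G) → Bool) → Fin (m G) → Set
  Inside X e = (X (ends G e Fin.zero) ≡ true) × (X (ends G e (Fin.suc Fin.zero)) ≡ true)
    where import Data.Fin as Fin

  δ : (Fin (n G) → Bool) → Fin (m G) → Bool
  δ X e = X (ends G e Fin.zero) xor X (ends G e (Fin.suc Fin.zero))
    where import Data.Fin as Fin

  cutSize : (Fin (n G) → Bool) → ℕ
  cutSize X = Σ[ m G ] (λ e → ⟦ δ X e ⟧)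

  data Reach (X : Fin (n G) → Bool) : Fin (n G) → Fin (n G) → Set where
    here : ∀ {u} → X u ≡ true → Reach X u u
    step : ∀ {u w x} e → Inside X e → Joins e u w → Reach X w x → Reach X u x

  ConnectedOn : (Fin (n G) → Bool) → Set
  ConnectedOn X = Σ (Fin (n G)) (λ v → X v ≡ true) ×
                  (∀ u w → X u ≡ true → X w ≡ true → Reach X u w)

  HasCircuitIn : (Fin (n G) → Bool) → Set
  HasCircuitIn X = Σ Circuit λ c → ∀ i → X (vs c i) ≡ true

  -- G[X] is 3-edge-colourable: a colouring of its edges such that any two
  -- distinct half-edges of G[X] at a common vertex get different colours
  -- (so a loop is never properly coloured)
  ThreeColourableOn : (Fin (n G) → Bool) → Set
  ThreeColourableOn X = Σ (Fin (m G) → Fin 3) λ c →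
    ∀ e i e' i' → Inside X e → Inside X e' → ¬ ((e , i) ≡ (e' , i')) →
      ends G e i ≡ ends G e' i' → ¬ (c e ≡ c e')

  complement : (Fin (n G) → Bool) → Fin (n G) → Bool
  complement X v = Data.Bool.not (X v)
    where import Data.Bool

module Submission where

-- Parity lemma: in a 3-edge-colouring of one side Y, colour a misses |Y| - 2|class a| vertices
-- of Y; these three numbers have the parity of |Y| and add up to |δ(Y)| = 4, so one of them
-- vanishes and that colour class is a perfect matching of G[Y].  The union M of such classes on
-- both sides is a perfect matching of G, and F = E - M is a 2-factor containing the four cut
-- edges.  A circuit of F that avoids the cut stays on one side and alternates between the two
-- remaining colours, so it is even; a circuit meeting the cut crosses it an even number of
-- times, hence at least twice.  So at most 4 / 2 = 2 circuits of F are odd.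

open import Defs
open import Data.Nat using (ℕ; zero; suc; _+_; _*_; _≤_; _<_; z≤n; s≤s; s≤s⁻¹; _%_; _/_)
open import Data.Nat.Properties hiding (_≟_)
open import Relation.Binary.Definitions using (tri<; tri≈; tri>)
open import Data.Fin using (Fin; zero; suc; toℕ; fromℕ<; combine; remQuot) renaming (_≟_ to _≟ᶠ_; _<_ to _<ᶠ_)
open import Data.Bool using (Bool; true; false; _∧_; _∨_; not; _xor_; if_then_else_)
open import Data.Bool.Properties using (∧-conicalˡ; ∧-conicalʳ; xor-same; xor-comm; xor-annihilates-not; ⇔→≡; ¬-not)
open import Function.Bundles using (mk⇔)
open import Data.Nat.DivMod using (%-distribˡ-+; [m+kn]%n≡m%n; m%n<n; n%n≡0; m<n⇒m%n≡m; m≡m%n+[m/n]*n)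
open import Data.Nat.Solver using (module +-*-Solver)
open import Data.Fin.Properties using (toℕ-fromℕ<; toℕ-injective; toℕ<n; pigeonhole; remQuot-combine; any?)
open import Data.List using (List; []; _∷_; map; allFin; tabulate; filter; length; cartesianProduct)
open import Data.List.Properties using (map-cong)
open import Data.List.Membership.Propositional using (_∈_)
open import Data.List.Membership.Propositional.Properties using (∈-filter⁺; ∈-filter⁻; ∈-cartesianProduct⁺; ∈-allFin)
open import Data.List.Relation.Unary.Any using (here; there)
open import Data.List.Relation.Unary.Unique.Propositional using (Unique)
open import Data.List.Relation.Unary.AllPairs using (_∷_)
open import Data.List.Relation.Unary.All using (_∷_; [])
open import Data.List.Relation.Unary.Unique.Propositional.Properties using (filter⁺; cartesianProduct⁺; allFin⁺)
open import Data.Product.Properties using (≡-dec)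
open import Relation.Nullary.Decidable using (_×-dec_; dec-true; dec-false)
open import Relation.Unary using (Decidable)
import Data.Bool.Properties as Bool
import Data.Nat.ListAction as List
open import Data.Product using (Σ; _×_; _,_; proj₁; proj₂; ∃; ∃₂)
open import Data.Sum using (_⊎_; inj₁; inj₂; [_,_]′)
open import Data.Empty using (⊥; ⊥-elim)
open import Relation.Nullary using (¬_; does; yes; no; contradiction; Dec)
open import Relation.Binary.PropositionalEquality hiding ([_])
open import Function using (_∘_; id)
import Data.Fin.Properties as FinP
open import Algebra.Properties.Semiring.Sum +-*-semiring
  using (sum-syntax; ∑-distrib-+; ∑-comm; *-distribˡ-sum; *-distribʳ-sum; sum-cong-≗)
  renaming (sum to ∑)

-- Arithmetic, finite sums and lists

⟦⟧≤1 : ∀ b → ⟦ b ⟧ ≤ 1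
⟦⟧≤1 true  = s≤s z≤n
⟦⟧≤1 false = z≤n

⟦⟧≤0 : ∀ {b} → ⟦ b ⟧ ≤ 0 → b ≡ false
⟦⟧≤0 {false} _ = refl

⟦⟧≥1 : ∀ {b} → 1 ≤ ⟦ b ⟧ → b ≡ true
⟦⟧≥1 {true} _ = refl

witness : ∀ {A : Set} (a? : Dec A) → does a? ≡ true → A
witness (yes a) _ = a

[≟]-sound : ∀ {k} {i j : Fin k} → 1 ≤ [ i ≟ j ] → i ≡ j
[≟]-sound {i = i} {j} 1≤ with i ≟ᶠ j
... | yes i≡j = i≡j

[≟]≡0 : ∀ {k} {i j : Fin k} → i ≢ j → [ i ≟ j ] ≡ 0
[≟]≡0 {i = i} {j} i≢j = cong ⟦_⟧ (dec-false (i ≟ᶠ j) i≢j)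

Σ≡∑ : ∀ k (f : Fin k → ℕ) → Σ[ k ] f ≡ ∑[ i < k ] f i
Σ≡∑ k f = go k id f
  where
  go : ∀ k {A : Set} (g : Fin k → A) (f : A → ℕ) → List.sum (map f (tabulate g)) ≡ ∑[ i < k ] f (g i)
  go zero    g f = refl
  go (suc k) g f = cong (f (g zero) +_) (go k (g ∘ suc) f)

∑-const0 : ∀ k → ∑[ i < k ] 0 ≡ 0
∑-const0 zero    = refl
∑-const0 (suc k) = ∑-const0 k

∑-const1 : ∀ k → ∑[ i < k ] 1 ≡ k
∑-const1 zero    = refl
∑-const1 (suc k) = cong suc (∑-const1 k)

∑-δ : ∀ {k} (j : Fin k) (f : Fin k → ℕ) → ∑[ i < k ] ([ j ≟ i ] * f i) ≡ f j
∑-δ {suc k} zero    f = trans (cong₂ _+_ (+-identityʳ (f zero)) (∑-const0 k)) (+-identityʳ (f zero))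
∑-δ {suc k} (suc j) f = ∑-δ j (f ∘ suc)

∑-mono-≤ : ∀ {k} {f g : Fin k → ℕ} → (∀ i → f i ≤ g i) → ∑ f ≤ ∑ g
∑-mono-≤ {zero}  f≤g = z≤n
∑-mono-≤ {suc k} f≤g = +-mono-≤ (f≤g zero) (∑-mono-≤ (f≤g ∘ suc))

∑-mono-< : ∀ {k} {f g : Fin k → ℕ} → (∀ i → f i ≤ g i) → ∀ j → f j < g j → ∑ f < ∑ g
∑-mono-< {suc k} f≤g zero    f<g = +-mono-<-≤ f<g (∑-mono-≤ (f≤g ∘ suc))
∑-mono-< {suc k} f≤g (suc j) f<g = +-mono-≤-< (f≤g zero) (∑-mono-< (f≤g ∘ suc) j f<g)

∑-single : ∀ {k} (f : Fin k → ℕ) j → f j ≤ ∑ f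
∑-single f zero    = m≤m+n _ _
∑-single f (suc j) = ≤-trans (∑-single (f ∘ suc) j) (m≤n+m _ _)

+-tight : ∀ {a b c d} → a ≤ c → b ≤ d → a + b ≡ c + d → a ≡ c × b ≡ d
+-tight {a} {b} {c} {d} a≤c b≤d eq = a≡c , +-cancelˡ-≡ a b d (trans eq (cong (_+ d) (sym a≡c)))
  where
  a≡c : a ≡ c
  a≡c = ≤-antisym a≤c (+-cancelʳ-≤ b c a (≤-trans (+-monoʳ-≤ c b≤d) (≤-reflexive (sym eq))))

∑-tight : ∀ {k} {f g : Fin k → ℕ} → (∀ i → f i ≤ g i) → ∑ f ≡ ∑ g → ∀ i → f i ≡ g i
∑-tight {suc k} f≤g eq i with +-tight (f≤g zero) (∑-mono-≤ (f≤g ∘ suc)) eq | i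
... | head≡ , _     | zero   = head≡
... | _     , tail≡ | suc i' = ∑-tight (f≤g ∘ suc) tail≡ i'

∑-atMostOne : ∀ {k} (f : Fin k → ℕ) → (∀ i → f i ≤ 1) → (∀ i j → 1 ≤ f i → 1 ≤ f j → i ≡ j) → ∑ f ≤ 1
∑-atMostOne {zero}  f f≤1 uniq = z≤n
∑-atMostOne {suc k} f f≤1 uniq with 1 ≤? f zero
... | no  f₀<1 = subst (λ x → x + ∑ (f ∘ suc) ≤ 1) (sym (n<1⇒n≡0 (≰⇒> f₀<1)))
                   (∑-atMostOne (f ∘ suc) (f≤1 ∘ suc) (λ i j p q → FinP.suc-injective (uniq (suc i) (suc j) p q)))
... | yes 1≤f₀ = subst (λ x → f zero + x ≤ 1) (sym rest≡0) (≤-trans (≤-reflexive (+-identityʳ _)) (f≤1 zero))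
  where
  rest≡0 : ∑ (f ∘ suc) ≡ 0
  rest≡0 = trans (sum-cong-≗ λ i → n<1⇒n≡0 (≰⇒> λ 1≤f → 0≢1+n (sym (cong toℕ (uniq (suc i) zero 1≤f 1≤f₀))))) (∑-const0 k)

⟦⟧%2 : ∀ b → ⟦ b ⟧ % 2 ≡ ⟦ b ⟧
⟦⟧%2 true  = refl
⟦⟧%2 false = refl

xor-chain : ∀ p q r → (⟦ p xor q ⟧ + ⟦ q xor r ⟧) % 2 ≡ ⟦ p xor r ⟧
xor-chain true  true  true  = refl
xor-chain true  true  false = refl
xor-chain true  false true  = refl
xor-chain true  false false = refl
xor-chain false true  true  = refl
xor-chain false true  false = refl
xor-chain false false true  = refl
xor-chain false false false = refl

+-%2-congʳ : ∀ a {b c} → b % 2 ≡ c % 2 → (a + b) % 2 ≡ (a + c) % 2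
+-%2-congʳ a {b} {c} eq = trans (%-distribˡ-+ a b 2) (trans (cong (λ x → (a % 2 + x) % 2) eq) (sym (%-distribˡ-+ a c 2)))

telescope : ∀ t (g : ℕ → Bool) → (∑[ i < t ] ⟦ g (toℕ i) xor g (suc (toℕ i)) ⟧) % 2 ≡ ⟦ g 0 xor g t ⟧
telescope zero    g = cong ⟦_⟧ (sym (xor-same (g 0)))
telescope (suc t) g = begin
  (⟦ g 0 xor g 1 ⟧ + ∑[ i < t ] ⟦ g (suc (toℕ i)) xor g (suc (suc (toℕ i))) ⟧) % 2
    ≡⟨ +-%2-congʳ ⟦ g 0 xor g 1 ⟧ (trans (telescope t (g ∘ suc)) (sym (⟦⟧%2 _))) ⟩
  (⟦ g 0 xor g 1 ⟧ + ⟦ g 1 xor g (suc t) ⟧) % 2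
    ≡⟨ xor-chain (g 0) (g 1) (g (suc t)) ⟩
  ⟦ g 0 xor g (suc t) ⟧ ∎
  where open ≡-Reasoning

even≡0∨≥2 : ∀ d → d % 2 ≡ 0 → d ≡ 0 ⊎ 2 ≤ d
even≡0∨≥2 zero          _ = inj₁ refl
even≡0∨≥2 (suc (suc d)) _ = inj₂ (s≤s (s≤s z≤n))

module _ (y : ℕ) (k d : Fin 3 → ℕ) (y≡ : ∀ a → 2 * k a + d a ≡ y)
         (3y≡ : 3 * y ≡ 2 * (k zero + (k (suc zero) + k (suc (suc zero)))) + 4) where

  open +-*-Solver using (solve; _:+_; _:*_; _:=_; con)
  private
    K = k zero + (k (suc zero) + k (suc (suc zero)))

  slacks-even : ∀ a → d a % 2 ≡ 0
  slacks-even a = begin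
    d a % 2                   ≡⟨ sym ([m+kn]%n≡m%n (d a) (k a) 2) ⟩
    (d a + k a * 2) % 2       ≡⟨ cong (_% 2) (trans (solve 2 (λ d k → d :+ k :* con 2 := con 2 :* k :+ d) refl (d a) (k a)) (y≡ a)) ⟩
    y % 2                     ≡⟨ sym ([m+kn]%n≡m%n y y 2) ⟩
    (y + y * 2) % 2           ≡⟨ cong (_% 2) (trans (solve 1 (λ y → y :+ y :* con 2 := con 3 :* y) refl y) 3y≡) ⟩
    (2 * K + 4) % 2           ≡⟨ cong (_% 2) (solve 1 (λ K → con 2 :* K :+ con 4 := con 0 :+ (K :+ con 2) :* con 2) refl K) ⟩
    (0 + (K + 2) * 2) % 2     ≡⟨ [m+kn]%n≡m%n 0 (K + 2) 2 ⟩
    0 ∎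
    where open ≡-Reasoning

  slacks-sum : d zero + (d (suc zero) + d (suc (suc zero))) ≡ 4
  slacks-sum = +-cancelˡ-≡ (2 * K) _ _ (begin
    2 * K + (d₀ + (d₁ + d₂))                         ≡⟨ regroup (k zero) (k (suc zero)) (k (suc (suc zero))) d₀ d₁ d₂ ⟩
    (2 * k zero + d₀) + ((2 * k (suc zero) + d₁) + (2 * k (suc (suc zero)) + d₂))
                                                     ≡⟨ cong₂ _+_ (y≡ zero) (cong₂ _+_ (y≡ (suc zero)) (y≡ (suc (suc zero)))) ⟩
    y + (y + y)                                      ≡⟨ solve 1 (λ y → y :+ (y :+ y) := con 3 :* y) refl y ⟩
    3 * y                                            ≡⟨ 3y≡ ⟩
    2 * K + 4                                        ∎)
    where
    open ≡-Reasoning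
    d₀ = d zero
    d₁ = d (suc zero)
    d₂ = d (suc (suc zero))
    regroup : ∀ k₀ k₁ k₂ d₀ d₁ d₂ → 2 * (k₀ + (k₁ + k₂)) + (d₀ + (d₁ + d₂)) ≡ (2 * k₀ + d₀) + ((2 * k₁ + d₁) + (2 * k₂ + d₂))
    regroup = solve 6 (λ k₀ k₁ k₂ d₀ d₁ d₂ → con 2 :* (k₀ :+ (k₁ :+ k₂)) :+ (d₀ :+ (d₁ :+ d₂))
                                          := (con 2 :* k₀ :+ d₀) :+ ((con 2 :* k₁ :+ d₁) :+ (con 2 :* k₂ :+ d₂))) refl

  someSlack≡0 : ∃ λ a → d a ≡ 0
  someSlack≡0 = pick (even≡0∨≥2 (d zero) (slacks-even zero)) (even≡0∨≥2 (d (suc zero)) (slacks-even (suc zero)))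
                     (even≡0∨≥2 (d (suc (suc zero))) (slacks-even (suc (suc zero))))
    where
    pick : d zero ≡ 0 ⊎ 2 ≤ d zero → d (suc zero) ≡ 0 ⊎ 2 ≤ d (suc zero) → d (suc (suc zero)) ≡ 0 ⊎ 2 ≤ d (suc (suc zero)) →
           ∃ λ a → d a ≡ 0
    pick (inj₁ d₀≡0) _ _ = zero , d₀≡0
    pick _ (inj₁ d₁≡0) _ = suc zero , d₁≡0
    pick _ _ (inj₁ d₂≡0) = suc (suc zero) , d₂≡0
    pick (inj₂ 2≤d₀) (inj₂ 2≤d₁) (inj₂ 2≤d₂) =
      contradiction (≤-trans (+-mono-≤ 2≤d₀ (+-mono-≤ 2≤d₁ 2≤d₂)) (≤-reflexive slacks-sum)) (<⇒≱ (s≤s (s≤s (s≤s (s≤s (s≤s z≤n))))))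

-- Otherwise u, w, x and y would be four distinct elements of Fin 3.
separates : ∀ {u w x y : Fin 3} → u ≢ w → x ≢ y → x ≢ u → y ≢ u → does (x ≟ᶠ w) ≢ does (y ≟ᶠ w)
separates {u} {w} {x} {y} u≢w x≢y x≢u y≢u with x ≟ᶠ w | y ≟ᶠ w
... | yes x≡w | yes y≡w = λ _ → x≢y (trans x≡w (sym y≡w))
... | yes _   | no _    = λ ()
... | no _    | yes _   = λ ()
... | no x≢w  | no y≢w  = λ _ → collide (pigeonhole (n<1+n 3) colour)
  where
  colour : Fin 4 → Fin 3
  colour zero                   = u
  colour (suc zero)             = w
  colour (suc (suc zero))       = x
  colour (suc (suc (suc zero))) = y
  collide : ¬ ∃₂ λ i j → i <ᶠ j × colour i ≡ colour j
  collide (zero , suc zero , _ , eq)                                  = u≢w eq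
  collide (zero , suc (suc zero) , _ , eq)                            = x≢u (sym eq)
  collide (zero , suc (suc (suc zero)) , _ , eq)                      = y≢u (sym eq)
  collide (suc zero , suc (suc zero) , _ , eq)                        = x≢w (sym eq)
  collide (suc zero , suc (suc (suc zero)) , _ , eq)                  = y≢w (sym eq)
  collide (suc (suc zero) , suc (suc (suc zero)) , _ , eq)            = x≢y eq
  collide (suc zero , suc zero , s≤s () , _)
  collide (suc (suc _) , suc zero , s≤s () , _)
  collide (suc (suc _) , suc (suc zero) , s≤s (s≤s ()) , _)
  collide (suc (suc (suc _)) , suc (suc (suc zero)) , s≤s (s≤s (s≤s ())) , _)

sum-filter : ∀ {A : Set} {P : A → Set} (P? : Decidable P) (g : A → ℕ) xs →
             List.sum (map g (filter P? xs)) ≡ List.sum (map (λ x → ⟦ does (P? x) ⟧ * g x) xs)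
sum-filter P? g []       = refl
sum-filter P? g (x ∷ xs) with does (P? x)
... | true  = cong₂ _+_ (sym (+-identityʳ (g x))) (sum-filter P? g xs)
... | false = sum-filter P? g xs

length≡sum : ∀ {A : Set} (xs : List A) → length xs ≡ List.sum (map (λ _ → 1) xs)
length≡sum []       = refl
length≡sum (x ∷ xs) = cong suc (length≡sum xs)

least-witness : ∀ {P : ℕ → Set} → (∀ q → Dec (P q)) → ∀ k → P k → ∃ λ p → P p × (∀ q → q < p → ¬ P q)
least-witness {P} P? k Pk with search (suc k)
  where
  search : ∀ k → (∀ q → q < k → ¬ P q) ⊎ ∃ λ p → P p × (∀ q → q < p → ¬ P q)
  search zero = inj₁ λ _ ()
  search (suc k) with search k
  ... | inj₂ found = inj₂ found
  ... | inj₁ none with P? k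
  ...   | yes Pk = inj₂ (k , Pk , none)
  ...   | no ¬Pk = inj₁ λ q q<1+k → [ (none q) , (λ { refl → ¬Pk }) ]′ (m≤n⇒m<n∨m≡n (s≤s⁻¹ q<1+k))
... | inj₁ none  = contradiction Pk (none k (n<1+n k))
... | inj₂ found = found

ZeroOrTwo : ℕ → Set
ZeroOrTwo d = d ≡ 0 ⊎ d ≡ 2

HalfEdge : Graph → Set
HalfEdge G = Fin (m G) × Fin 2

module _ {G : Graph} where

  -- Degrees and the handshake lemma

  edge : HalfEdge G → Fin (m G)
  edge = proj₁

  end : HalfEdge G → Fin (n G)
  end (e , s) = ends G e s

  incidence : Fin (m G) → Fin (n G) → ℕ
  incidence e v = [ ends G e zero ≟ v ] + [ ends G e (suc zero) ≟ v ]

  degIn≡∑ : ∀ F v → degIn G F v ≡ ∑[ e < m G ] (⟦ F e ⟧ * incidence e v)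
  degIn≡∑ F v = Σ≡∑ (m G) _

  degIn-+ : ∀ {A B C} → (∀ e → ⟦ A e ⟧ + ⟦ B e ⟧ ≡ ⟦ C e ⟧) → ∀ v → degIn G A v + degIn G B v ≡ degIn G C v
  degIn-+ {A} {B} {C} partition v = begin
    degIn G A v + degIn G B v
      ≡⟨ cong₂ _+_ (degIn≡∑ A v) (degIn≡∑ B v) ⟩
    ∑[ e < m G ] (⟦ A e ⟧ * incidence e v) + ∑[ e < m G ] (⟦ B e ⟧ * incidence e v)
      ≡⟨ sym (∑-distrib-+ (λ e → ⟦ A e ⟧ * incidence e v) (λ e → ⟦ B e ⟧ * incidence e v)) ⟩
    ∑[ e < m G ] (⟦ A e ⟧ * incidence e v + ⟦ B e ⟧ * incidence e v)
      ≡⟨ sum-cong-≗ (λ e → trans (sym (*-distribʳ-+ (incidence e v) ⟦ A e ⟧ ⟦ B e ⟧)) (cong (_* incidence e v) (partition e))) ⟩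
    ∑[ e < m G ] (⟦ C e ⟧ * incidence e v)
      ≡⟨ sym (degIn≡∑ C v) ⟩
    degIn G C v ∎
    where open ≡-Reasoning

  degIn-avoid : ∀ {A v} → (∀ e s → A e ≡ true → ends G e s ≢ v) → degIn G A v ≡ 0
  degIn-avoid {A} {v} avoid = trans (degIn≡∑ A v) (trans (sum-cong-≗ term≡0) (∑-const0 (m G)))
    where
    term≡0 : ∀ e → ⟦ A e ⟧ * incidence e v ≡ 0
    term≡0 e with A e in Ae
    ... | false = refl
    ... | true  = cong₂ (λ x y → (x + y) + 0) ([≟]≡0 (avoid e zero Ae)) ([≟]≡0 (avoid e (suc zero) Ae))

  Matching : (Fin (m G) → Bool) → Set
  Matching A = ∀ (h h' : HalfEdge G) → A (edge h) ≡ true → A (edge h') ≡ true → h ≢ h' → end h ≢ end h'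

  incident : ∀ (A : Fin (m G) → Bool) e v → 1 ≤ ⟦ A e ⟧ * incidence e v → A e ≡ true × ∃ λ s → ends G e s ≡ v
  incident A e v 1≤ with A e | ends G e zero ≟ᶠ v | ends G e (suc zero) ≟ᶠ v
  ... | true | yes e₀≡v | _        = refl , zero , e₀≡v
  ... | true | no _     | yes e₁≡v = refl , suc zero , e₁≡v
  ... | true | no _     | no _     = contradiction 1≤ λ ()
  ... | false | _ | _ = contradiction 1≤ λ ()

  degIn-matching : ∀ {A} → Matching A → ∀ v → degIn G A v ≤ 1
  degIn-matching {A} matching v =
    subst (_≤ 1) (sym (degIn≡∑ A v)) (∑-atMostOne (λ e → ⟦ A e ⟧ * incidence e v) term≤1 unique)
    where
    term≤1 : ∀ e → ⟦ A e ⟧ * incidence e v ≤ 1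
    term≤1 e with A e in Ae | ends G e zero ≟ᶠ v | ends G e (suc zero) ≟ᶠ v
    ... | false | _        | _        = z≤n
    ... | true  | yes e₀≡v | yes e₁≡v = contradiction (trans e₀≡v (sym e₁≡v)) (matching (e , zero) (e , suc zero) Ae Ae λ ())
    ... | true  | yes _    | no _     = s≤s z≤n
    ... | true  | no _     | yes _    = s≤s z≤n
    ... | true  | no _     | no _     = z≤n
    unique : ∀ e e' → 1 ≤ ⟦ A e ⟧ * incidence e v → 1 ≤ ⟦ A e' ⟧ * incidence e' v → e ≡ e'
    unique e e' p q with incident A e v p | incident A e' v q | e ≟ᶠ e'
    ... | _ | _ | yes e≡e' = e≡e'
    ... | Ae , s , es≡v | Ae' , s' , es'≡v | no e≢e' =
      contradiction (trans es≡v (sym es'≡v)) (matching (e , s) (e' , s') Ae Ae' λ h≡h' → e≢e' (cong proj₁ h≡h'))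

  handshake : ∀ (w : Fin (n G) → ℕ) A →
    ∑[ v < n G ] (w v * degIn G A v) ≡ ∑[ e < m G ] (⟦ A e ⟧ * (w (ends G e zero) + w (ends G e (suc zero))))
  handshake w A = begin
    ∑[ v < n G ] (w v * degIn G A v)
      ≡⟨ sum-cong-≗ (λ v → trans (cong (w v *_) (degIn≡∑ A v)) (*-distribˡ-sum (w v) (λ e → ⟦ A e ⟧ * incidence e v))) ⟩
    ∑[ v < n G ] ∑[ e < m G ] (w v * (⟦ A e ⟧ * incidence e v))
      ≡⟨ ∑-comm (λ v e → w v * (⟦ A e ⟧ * incidence e v)) ⟩
    ∑[ e < m G ] ∑[ v < n G ] (w v * (⟦ A e ⟧ * incidence e v))
      ≡⟨ sum-cong-≗ (λ e → perEdge (ends G e zero) (ends G e (suc zero)) ⟦ A e ⟧) ⟩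
    ∑[ e < m G ] (⟦ A e ⟧ * (w (ends G e zero) + w (ends G e (suc zero)))) ∎
    where
    open ≡-Reasoning
    open +-*-Solver using (solve; _:+_; _:*_; _:=_)
    regroup : ∀ x a p q → x * (a * (p + q)) ≡ a * (p * x + q * x)
    regroup = solve 4 (λ x a p q → x :* (a :* (p :+ q)) := a :* (p :* x :+ q :* x)) refl
    perEdge : ∀ u₀ u₁ a → ∑[ v < n G ] (w v * (a * ([ u₀ ≟ v ] + [ u₁ ≟ v ]))) ≡ a * (w u₀ + w u₁)
    perEdge u₀ u₁ a = begin
      ∑[ v < n G ] (w v * (a * ([ u₀ ≟ v ] + [ u₁ ≟ v ])))
        ≡⟨ sum-cong-≗ (λ v → regroup (w v) a [ u₀ ≟ v ] [ u₁ ≟ v ]) ⟩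
      ∑[ v < n G ] (a * ([ u₀ ≟ v ] * w v + [ u₁ ≟ v ] * w v))
        ≡⟨ sym (*-distribˡ-sum a (λ v → [ u₀ ≟ v ] * w v + [ u₁ ≟ v ] * w v)) ⟩
      a * ∑[ v < n G ] ([ u₀ ≟ v ] * w v + [ u₁ ≟ v ] * w v)
        ≡⟨ cong (a *_) (trans (∑-distrib-+ (λ v → [ u₀ ≟ v ] * w v) (λ v → [ u₁ ≟ v ] * w v)) (cong₂ _+_ (∑-δ u₀ w) (∑-δ u₁ w))) ⟩
      a * (w u₀ + w u₁) ∎

  -- The parity lemma

  ProperOn : (Fin (n G) → Bool) → (Fin (m G) → Fin 3) → Set
  ProperOn Y φ = ∀ e i e' i' → Inside G Y e → Inside G Y e' → ¬ ((e , i) ≡ (e' , i')) →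
                   ends G e i ≡ ends G e' i' → ¬ (φ e ≡ φ e')

  insideᵇ : (Fin (n G) → Bool) → Fin (m G) → Bool
  insideᵇ Y e = Y (ends G e zero) ∧ Y (ends G e (suc zero))

  colourClass : (Fin (n G) → Bool) → (Fin (m G) → Fin 3) → Fin 3 → Fin (m G) → Bool
  colourClass Y φ a e = insideᵇ Y e ∧ does (φ e ≟ᶠ a)

  colourClass⇒Inside : ∀ {Y φ a e} → colourClass Y φ a e ≡ true → Inside G Y e
  colourClass⇒Inside {Y} {φ} {a} {e} c = ∧-conicalˡ (Y (ends G e zero)) _ inside , ∧-conicalʳ (Y (ends G e zero)) _ inside
    where inside = ∧-conicalˡ (insideᵇ Y e) _ c

  colourClass⇒colour : ∀ {Y φ a e} → colourClass Y φ a e ≡ true → φ e ≡ a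
  colourClass⇒colour {Y} {φ} {a} {e} c with φ e ≟ᶠ a
  ... | yes φe≡a = φe≡a
  ... | no _     = contradiction (∧-conicalʳ (insideᵇ Y e) _ c) λ ()

  colourClass-matching : ∀ {Y φ} a → ProperOn Y φ → Matching (colourClass Y φ a)
  colourClass-matching {Y} {φ} a proper (e , s) (e' , s') c c' h≢h' same =
    proper e s e' s' (colourClass⇒Inside {Y} {φ} {a} c) (colourClass⇒Inside {Y} {φ} {a} c') h≢h' same
      (trans (colourClass⇒colour {Y} {φ} c) (sym (colourClass⇒colour {Y} {φ} c')))

  vertexCount : (Fin (n G) → Bool) → ℕ
  vertexCount Y = ∑[ v < n G ] ⟦ Y v ⟧

  edgeCount : (Fin (m G) → Bool) → ℕ
  edgeCount A = ∑[ e < m G ] ⟦ A e ⟧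

  coverage : (Fin (n G) → Bool) → (Fin (m G) → Bool) → ℕ
  coverage Y A = ∑[ v < n G ] (⟦ Y v ⟧ * degIn G A v)

  coverage-colourClass : ∀ (Y : Fin (n G) → Bool) φ a → coverage Y (colourClass Y φ a) ≡ 2 * edgeCount (colourClass Y φ a)
  coverage-colourClass Y φ a = begin
    coverage Y (colourClass Y φ a)
      ≡⟨ handshake (λ v → ⟦ Y v ⟧) (colourClass Y φ a) ⟩
    ∑[ e < m G ] (⟦ colourClass Y φ a e ⟧ * (⟦ Y (ends G e zero) ⟧ + ⟦ Y (ends G e (suc zero)) ⟧))
      ≡⟨ sum-cong-≗ (λ e → twice (Y (ends G e zero)) (Y (ends G e (suc zero))) (does (φ e ≟ᶠ a))) ⟩
    ∑[ e < m G ] (2 * ⟦ colourClass Y φ a e ⟧)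
      ≡⟨ sym (*-distribˡ-sum 2 (λ e → ⟦ colourClass Y φ a e ⟧)) ⟩
    2 * edgeCount (colourClass Y φ a) ∎
    where
    open ≡-Reasoning
    twice : ∀ p q b → ⟦ (p ∧ q) ∧ b ⟧ * (⟦ p ⟧ + ⟦ q ⟧) ≡ 2 * ⟦ (p ∧ q) ∧ b ⟧
    twice true  true  true  = refl
    twice true  true  false = refl
    twice true  false b     = refl
    twice false q     b     = refl

  coverage-matching : ∀ (Y : Fin (n G) → Bool) {A : Fin (m G) → Bool} → Matching A → (∀ v → ⟦ Y v ⟧ * degIn G A v ≤ ⟦ Y v ⟧)
  coverage-matching Y matching v = ≤-trans (*-monoʳ-≤ ⟦ Y v ⟧ (degIn-matching matching v)) (≤-reflexive (*-identityʳ ⟦ Y v ⟧))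

  coverage≡vertexCount : ∀ (Y : Fin (n G) → Bool) {A : Fin (m G) → Bool} → Matching A → coverage Y A ≡ vertexCount Y → ∀ v → Y v ≡ true → degIn G A v ≡ 1
  coverage≡vertexCount Y {A} matching full v Yv =
    trans (sym (+-identityʳ _)) (subst (λ b → ⟦ b ⟧ * degIn G A v ≡ ⟦ b ⟧) Yv (∑-tight (coverage-matching Y matching) full v))

  side-handshake : ∀ (Y : Fin (n G) → Bool) φ → Cubic G →
    3 * vertexCount Y ≡ 2 * (edgeCount (colourClass Y φ zero) + (edgeCount (colourClass Y φ (suc zero)) + edgeCount (colourClass Y φ (suc (suc zero)))))
                        + cutSize G Y
  side-handshake Y φ cubic = begin
    3 * vertexCount Y                         ≡⟨ *-comm 3 (vertexCount Y) ⟩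
    vertexCount Y * 3                         ≡⟨ *-distribʳ-sum 3 (λ v → ⟦ Y v ⟧) ⟩
    ∑[ v < n G ] (⟦ Y v ⟧ * 3)                ≡⟨ sum-cong-≗ (λ v → cong (⟦ Y v ⟧ *_) (sym (cubic v))) ⟩
    ∑[ v < n G ] (⟦ Y v ⟧ * deg G v)          ≡⟨ handshake (λ v → ⟦ Y v ⟧) (λ _ → true) ⟩
    ∑[ e < m G ] (⟦ true ⟧ * (⟦ Y (ends G e zero) ⟧ + ⟦ Y (ends G e (suc zero)) ⟧))
      ≡⟨ sum-cong-≗ (λ e → split (Y (ends G e zero)) (Y (ends G e (suc zero))) (φ e)) ⟩
    ∑[ e < m G ] (2 * (class₀ e + (class₁ e + class₂ e)) + ⟦ δ G Y e ⟧)
      ≡⟨ ∑-distrib-+ (λ e → 2 * (class₀ e + (class₁ e + class₂ e))) (λ e → ⟦ δ G Y e ⟧) ⟩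
    ∑[ e < m G ] (2 * (class₀ e + (class₁ e + class₂ e))) + ∑[ e < m G ] ⟦ δ G Y e ⟧
      ≡⟨ cong₂ _+_ (sym (*-distribˡ-sum 2 (λ e → class₀ e + (class₁ e + class₂ e)))) (sym (Σ≡∑ (m G) _)) ⟩
    2 * ∑[ e < m G ] (class₀ e + (class₁ e + class₂ e)) + cutSize G Y
      ≡⟨ cong (λ x → 2 * x + cutSize G Y) (trans (∑-distrib-+ class₀ (λ e → class₁ e + class₂ e))
                                                 (cong (edgeCount (colourClass Y φ zero) +_) (∑-distrib-+ class₁ class₂))) ⟩
    2 * (edgeCount (colourClass Y φ zero) + (edgeCount (colourClass Y φ (suc zero)) + edgeCount (colourClass Y φ (suc (suc zero)))))
      + cutSize G Y ∎
    where
    open ≡-Reasoning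
    class₀ class₁ class₂ : Fin (m G) → ℕ
    class₀ e = ⟦ colourClass Y φ zero e ⟧
    class₁ e = ⟦ colourClass Y φ (suc zero) e ⟧
    class₂ e = ⟦ colourClass Y φ (suc (suc zero)) e ⟧
    split : ∀ p q (c : Fin 3) →
      ⟦ true ⟧ * (⟦ p ⟧ + ⟦ q ⟧) ≡
        2 * (⟦ (p ∧ q) ∧ does (c ≟ᶠ zero) ⟧ + (⟦ (p ∧ q) ∧ does (c ≟ᶠ suc zero) ⟧ + ⟦ (p ∧ q) ∧ does (c ≟ᶠ suc (suc zero)) ⟧))
          + ⟦ p xor q ⟧
    split true  true  zero             = refl
    split true  true  (suc zero)       = refl
    split true  true  (suc (suc zero)) = refl
    split true  false c                = refl
    split false true  c                = refl
    split false false c                = refl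

  perfectColourClass : ∀ {Y φ} → Cubic G → cutSize G Y ≡ 4 → ProperOn Y φ →
                       ∃ λ a → ∀ v → Y v ≡ true → degIn G (colourClass Y φ a) v ≡ 1
  perfectColourClass {Y} {φ} cubic cut≡4 proper =
    let a , noneMissing = someSlack≡0 (vertexCount Y) size missing |Y|≡ (trans (side-handshake Y φ cubic) (cong (2 * (size zero + (size (suc zero) + size (suc (suc zero)))) +_) cut≡4))
    in a , covered a noneMissing
    where
    size : Fin 3 → ℕ
    size a = edgeCount (colourClass Y φ a)
    matching : ∀ a → Matching (colourClass Y φ a)
    matching a = colourClass-matching {Y} {φ} a proper
    slack : ∀ a → ∃ λ d → coverage Y (colourClass Y φ a) + d ≡ vertexCount Y
    slack a = m≤n⇒∃[o]m+o≡n (∑-mono-≤ (coverage-matching Y {colourClass Y φ a} (matching a)))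
    missing : Fin 3 → ℕ
    missing a = proj₁ (slack a)
    |Y|≡ : ∀ a → 2 * size a + missing a ≡ vertexCount Y
    |Y|≡ a = trans (cong (_+ missing a) (sym (coverage-colourClass Y φ a))) (proj₂ (slack a))
    covered : ∀ a → missing a ≡ 0 → ∀ v → Y v ≡ true → degIn G (colourClass Y φ a) v ≡ 1
    covered a noneMissing = coverage≡vertexCount Y (matching a)
      (trans (coverage-colourClass Y φ a) (trans (sym (+-identityʳ _)) (trans (cong (2 * size a +_) (sym noneMissing)) (|Y|≡ a))))

  -- A perfect matching and the complementary 2-factor

  ⟦∨⟧ : ∀ a b → ¬ (a ≡ true × b ≡ true) → ⟦ a ⟧ + ⟦ b ⟧ ≡ ⟦ a ∨ b ⟧
  ⟦∨⟧ true  true  both = contradiction (refl , refl) both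
  ⟦∨⟧ true  false _    = refl
  ⟦∨⟧ false b     _    = refl

  Inside⇒end : ∀ {Y e} → Inside G Y e → ∀ s → Y (ends G e s) ≡ true
  Inside⇒end (Ye₀ , _) zero       = Ye₀
  Inside⇒end (_ , Ye₁) (suc zero) = Ye₁

  perfectMatching-∨ : ∀ {X A B} →
    (∀ e → A e ≡ true → Inside G X e) → (∀ e → B e ≡ true → Inside G (complement G X) e) →
    (∀ v → X v ≡ true → degIn G A v ≡ 1) → (∀ v → X v ≡ false → degIn G B v ≡ 1) →
    ∀ v → degIn G (λ e → A e ∨ B e) v ≡ 1
  perfectMatching-∨ {X} {A} {B} A⊆X B⊆Xᶜ coverA coverB v = trans (sym (degIn-+ {A} {B} disjoint v)) (bySide (X v) refl)
    where
    disjoint : ∀ e → ⟦ A e ⟧ + ⟦ B e ⟧ ≡ ⟦ A e ∨ B e ⟧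
    disjoint e = ⟦∨⟧ (A e) (B e) λ (Ae , Be) →
      contradiction (trans (cong not (sym (proj₁ (A⊆X e Ae)))) (proj₁ (B⊆Xᶜ e Be))) λ ()
    bySide : ∀ b → X v ≡ b → degIn G A v + degIn G B v ≡ 1
    bySide true  Xv = cong₂ _+_ (coverA v Xv) (degIn-avoid λ e s Be es≡v →
      contradiction (trans (cong (not ∘ X) (sym es≡v)) (Inside⇒end {complement G X} {e} (B⊆Xᶜ e Be) s)) (subst (λ b → not b ≢ true) (sym Xv) λ ()))
    bySide false Xv = cong₂ _+_ (degIn-avoid λ e s Ae es≡v →
      contradiction (trans (cong X (sym es≡v)) (Inside⇒end {X} {e} (A⊆X e Ae) s)) (subst (_≢ true) (sym Xv) λ ())) (coverB v Xv)

  complement-perfectMatching : ∀ {M} → Cubic G → (∀ v → degIn G M v ≡ 1) → TwoFactor G (not ∘ M)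
  complement-perfectMatching {M} cubic perfect v =
    +-cancelˡ-≡ 1 _ _ (trans (cong (_+ degIn G (not ∘ M) v) (sym (perfect v))) (trans (degIn-+ {M} {not ∘ M} partition v) (cubic v)))
    where
    partition : ∀ e → ⟦ M e ⟧ + ⟦ not (M e) ⟧ ≡ ⟦ true ⟧
    partition e with M e
    ... | true  = refl
    ... | false = refl

  -- Odd circuits and the cut

  -- The periodic extension of a cyclic sequence turns the wrap-around step into an ordinary one.
  cyclic-changes-even : ∀ {l} (f : Fin (suc l) → Bool) → (∑[ i < suc l ] ⟦ f i xor f (next G i) ⟧) % 2 ≡ 0
  cyclic-changes-even {l} f = begin
    (∑[ i < suc l ] ⟦ f i xor f (next G i) ⟧) % 2
      ≡⟨ cong (_% 2) (sum-cong-≗ λ i → cong (λ x → ⟦ x xor f (next G i) ⟧) (cong f (toℕ-injective (sym (toℕ-periodic i))))) ⟩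
    (∑[ i < suc l ] ⟦ g (toℕ i) xor g (suc (toℕ i)) ⟧) % 2
      ≡⟨ telescope (suc l) g ⟩
    ⟦ g 0 xor g (suc l) ⟧
      ≡⟨ cong (λ x → ⟦ g 0 xor f x ⟧) (toℕ-injective (trans (toℕ-fromℕ< _) (n%n≡0 (suc l)))) ⟩
    ⟦ g 0 xor g 0 ⟧
      ≡⟨ cong ⟦_⟧ (xor-same (g 0)) ⟩
    0 ∎
    where
    open ≡-Reasoning
    g : ℕ → Bool
    g t = f (fromℕ< (m%n<n t (suc l)))
    toℕ-periodic : ∀ (i : Fin (suc l)) → toℕ (fromℕ< (m%n<n (toℕ i) (suc l))) ≡ toℕ i
    toℕ-periodic i = trans (toℕ-fromℕ< _) (m<n⇒m%n≡m (toℕ<n i))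

  alternating⇒even : ∀ {l} (f : Fin (suc l) → Bool) → (∀ i → f i ≢ f (next G i)) → suc l % 2 ≡ 0
  alternating⇒even {l} f alt =
    trans (cong (_% 2) (trans (sym (∑-const1 (suc l))) (sum-cong-≗ λ i → cong ⟦_⟧ (sym (xor-≢ (alt i))))))
          (cyclic-changes-even f)
    where
    xor-≢ : ∀ {p q} → p ≢ q → p xor q ≡ true
    xor-≢ {true}  {true}  p≢q = contradiction refl p≢q
    xor-≢ {true}  {false} _   = refl
    xor-≢ {false} {true}  _   = refl
    xor-≢ {false} {false} p≢q = contradiction refl p≢q

  next-≢ : ∀ {l} (i : Fin (suc (suc l))) → next G i ≢ i
  next-≢ {l} i next≡i with m≤n⇒m<n∨m≡n (s≤s⁻¹ (toℕ<n i))
  ... | inj₁ i<last = 1+n≢n (trans (sym (trans (toℕ-fromℕ< _) (m<n⇒m%n≡m (s≤s i<last)))) (cong toℕ next≡i))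
  ... | inj₂ i≡last = 0≢1+n (trans (sym (trans (toℕ-fromℕ< _) (trans (cong (λ t → suc t % suc (suc l)) i≡last) (n%n≡0 (suc (suc l))))))
                                  (trans (cong toℕ next≡i) i≡last))

  arrival : ∀ {e u w} → Joins G e u w → ∃ λ s → ends G e s ≡ w
  arrival (inj₁ (_ , e₁≡w)) = suc zero , e₁≡w
  arrival (inj₂ (e₀≡w , _)) = zero , e₀≡w

  departure : ∀ {e u w} → Joins G e u w → ∃ λ s → ends G e s ≡ u
  departure (inj₁ (e₀≡u , _)) = zero , e₀≡u
  departure (inj₂ (_ , e₁≡u)) = suc zero , e₁≡u

  Alternating : (Fin (m G) → Bool) → (Fin (m G) → Bool) → Set
  Alternating S β = ∀ (h h' : HalfEdge G) → S (edge h) ≡ true → S (edge h') ≡ true → h ≢ h' → end h ≡ end h' → β (edge h) ≢ β (edge h')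

  alternating-circuit-even : ∀ {S β} → Alternating S β → (c : Circuit G) → (∀ i → S (es c i) ≡ true) → oddC G c ≡ 0
  alternating-circuit-even alt record { len = zero ; es = es ; joins = joins } inS with joins zero
  ... | inj₁ (e₀≡v , e₁≡v) = contradiction refl (alt (es zero , zero) (es zero , suc zero) (inS zero) (inS zero) (λ ()) (trans e₀≡v (sym e₁≡v)))
  ... | inj₂ (e₀≡v , e₁≡v) = contradiction refl (alt (es zero , zero) (es zero , suc zero) (inS zero) (inS zero) (λ ()) (trans e₀≡v (sym e₁≡v)))
  alternating-circuit-even {S} {β} alt record { len = suc l ; es = es ; es-inj = es-inj ; joins = joins } inS =
    alternating⇒even (β ∘ es) λ i →
      let s , arrives = arrival (joins i)
          s' , departs = departure (joins (next G i))
      in alt (es i , s) (es (next G i) , s') (inS i) (inS (next G i))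
             (λ h≡h' → next-≢ i (sym (es-inj (cong proj₁ h≡h')))) (trans arrives (sym departs))

  crossings : (Fin (n G) → Bool) → Circuit G → ℕ
  crossings X c = ∑[ i < suc (len c) ] ⟦ δ G X (es c i) ⟧

  crossings-even : ∀ X c → crossings X c % 2 ≡ 0
  crossings-even X c = trans (cong (_% 2) (sum-cong-≗ λ i → cong ⟦_⟧ (δ-joins (joins c i)))) (cyclic-changes-even (X ∘ vs c))
    where
    δ-joins : ∀ {e u w} → Joins G e u w → δ G X e ≡ X u xor X w
    δ-joins (inj₁ (refl , refl)) = refl
    δ-joins {e} (inj₂ (refl , refl)) = xor-comm (X (ends G e zero)) (X (ends G e (suc zero)))

  crossings≡ : ∀ X c → crossings X c ≡ ∑[ e < m G ] (⟦ δ G X e ⟧ * occ G c e)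
  crossings≡ X c = sym (begin
    ∑[ e < m G ] (⟦ δ G X e ⟧ * occ G c e)
      ≡⟨ sum-cong-≗ (λ e → trans (cong (⟦ δ G X e ⟧ *_) (Σ≡∑ (suc (len c)) _)) (*-distribˡ-sum ⟦ δ G X e ⟧ (λ i → [ es c i ≟ e ]))) ⟩
    ∑[ e < m G ] ∑[ i < suc (len c) ] (⟦ δ G X e ⟧ * [ es c i ≟ e ])
      ≡⟨ ∑-comm (λ e i → ⟦ δ G X e ⟧ * [ es c i ≟ e ]) ⟩
    ∑[ i < suc (len c) ] ∑[ e < m G ] (⟦ δ G X e ⟧ * [ es c i ≟ e ])
      ≡⟨ sum-cong-≗ (λ i → trans (sum-cong-≗ λ e → *-comm ⟦ δ G X e ⟧ [ es c i ≟ e ]) (∑-δ (es c i) (λ e → ⟦ δ G X e ⟧))) ⟩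
    crossings X c ∎)
    where open ≡-Reasoning

  occ-es : ∀ c i → 1 ≤ occ G c (es c i)
  occ-es c i = subst (1 ≤_) (sym (Σ≡∑ (suc (len c)) _))
                 (≤-trans (≤-reflexive (sym (cong ⟦_⟧ (dec-true (es c i ≟ᶠ es c i) refl)))) (∑-single (λ j → [ es c j ≟ es c i ]) i))

  oddC≤crossings : ∀ {F : Fin (m G) → Bool} {X β} → Alternating (λ e → F e ∧ not (δ G X e)) β →
                   (c : Circuit G) → (∀ i → F (es c i) ≡ true) → 2 * oddC G c ≤ crossings X c
  oddC≤crossings {F} {X} alt c inF with crossings X c in crossings≡k
  ... | zero          = ≤-reflexive (cong (2 *_) (alternating-circuit-even {λ e → F e ∧ not (δ G X e)} alt c inS))
    where
    uncut : ∀ i → δ G X (es c i) ≡ false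
    uncut i = ⟦⟧≤0 (subst (⟦ δ G X (es c i) ⟧ ≤_) crossings≡k (∑-single (λ j → ⟦ δ G X (es c j) ⟧) i))
    inS : ∀ i → F (es c i) ∧ not (δ G X (es c i)) ≡ true
    inS i = cong₂ (λ a b → a ∧ not b) (inF i) (uncut i)
  ... | suc zero      = contradiction (subst (λ k → k % 2 ≡ 0) crossings≡k (crossings-even X c)) λ ()
  ... | suc (suc _)   = ≤-trans (*-monoʳ-≤ 2 (s≤s⁻¹ (m%n<n (suc (len c)) 2))) (s≤s (s≤s z≤n))

  oddCircuits-bound : ∀ {F : Fin (m G) → Bool} {X β} → Alternating (λ e → F e ∧ not (δ G X e)) β →
                      ∀ cs → CircuitsOf G F cs → 2 * List.sum (map (oddC G) cs) ≤ cutSize G X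
  oddCircuits-bound {F} {X} alt cs decomposition = begin
    2 * List.sum (map (oddC G) cs)                ≤⟨ bound cs (λ e → ≤-reflexive (decomposition e)) ⟩
    ∑[ e < m G ] (⟦ δ G X e ⟧ * total cs e)        ≤⟨ ∑-mono-≤ (λ e → ≤-trans (*-monoʳ-≤ ⟦ δ G X e ⟧ (≤-trans (≤-reflexive (decomposition e)) (⟦⟧≤1 (F e))))
                                                                             (≤-reflexive (*-identityʳ _))) ⟩
    ∑[ e < m G ] ⟦ δ G X e ⟧                        ≡⟨ sym (Σ≡∑ (m G) _) ⟩
    cutSize G X                                    ∎
    where
    open ≤-Reasoning
    total : List (Circuit G) → Fin (m G) → ℕ
    total cs e = List.sum (map (λ c → occ G c e) cs)
    bound : ∀ cs → (∀ e → total cs e ≤ ⟦ F e ⟧) → 2 * List.sum (map (oddC G) cs) ≤ ∑[ e < m G ] (⟦ δ G X e ⟧ * total cs e)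
    bound []       _      = z≤n
    bound (c ∷ cs) total≤ = begin
      2 * (oddC G c + List.sum (map (oddC G) cs))                           ≡⟨ *-distribˡ-+ 2 (oddC G c) _ ⟩
      2 * oddC G c + 2 * List.sum (map (oddC G) cs)                         ≤⟨ +-mono-≤ (oddC≤crossings {F} {X} alt c inF) (bound cs rest≤) ⟩
      crossings X c + ∑[ e < m G ] (⟦ δ G X e ⟧ * total cs e)              ≡⟨ cong (_+ _) (crossings≡ X c) ⟩
      ∑[ e < m G ] (⟦ δ G X e ⟧ * occ G c e) + ∑[ e < m G ] (⟦ δ G X e ⟧ * total cs e)
                                                                             ≡⟨ sym (∑-distrib-+ (λ e → ⟦ δ G X e ⟧ * occ G c e) (λ e → ⟦ δ G X e ⟧ * total cs e)) ⟩
      ∑[ e < m G ] (⟦ δ G X e ⟧ * occ G c e + ⟦ δ G X e ⟧ * total cs e)    ≡⟨ sum-cong-≗ (λ e → sym (*-distribˡ-+ ⟦ δ G X e ⟧ (occ G c e) (total cs e))) ⟩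
      ∑[ e < m G ] (⟦ δ G X e ⟧ * total (c ∷ cs) e)                         ∎
      where
      rest≤ : ∀ e → total cs e ≤ ⟦ F e ⟧
      rest≤ e = ≤-trans (m≤n+m (total cs e) (occ G c e)) (total≤ e)
      inF : ∀ i → F (es c i) ≡ true
      inF i = ⟦⟧≥1 (≤-trans (occ-es c i) (≤-trans (m≤m+n _ _) (total≤ (es c i))))

  uncut⇒Inside : ∀ {Y} (h : HalfEdge G) → Y (end h) ≡ true → δ G Y (edge h) ≡ false → Inside G Y (edge h)
  uncut⇒Inside {Y} (e , zero) Ye₀ uncut with Y (ends G e (suc zero))
  ... | true  = Ye₀ , refl
  ... | false = contradiction (trans (sym (cong (_xor false) Ye₀)) uncut) λ ()
  uncut⇒Inside {Y} (e , suc zero) Ye₁ uncut with Y (ends G e zero)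
  ... | true  = refl , Ye₁
  ... | false = contradiction (trans (sym (cong (false xor_) Ye₁)) uncut) λ ()

  other : Fin 3 → Fin 3
  other zero    = suc zero
  other (suc _) = zero

  other-≢ : ∀ u → u ≢ other u
  other-≢ zero    ()
  other-≢ (suc _) ()

  -- Off the colour class u, the edges of a side carry the two other colours, so testing for one of them alternates.
  side-alternating : ∀ {Y φ u} → ProperOn Y φ → ∀ (h h' : HalfEdge G) → Y (end h) ≡ true →
    δ G Y (edge h) ≡ false → δ G Y (edge h') ≡ false →
    colourClass Y φ u (edge h) ≡ false → colourClass Y φ u (edge h') ≡ false →
    h ≢ h' → end h ≡ end h' → does (φ (edge h) ≟ᶠ other u) ≢ does (φ (edge h') ≟ᶠ other u)
  side-alternating {Y} {φ} {u} proper h@(e , s) h'@(e' , s') Yv uncut uncut' notU notU' h≢h' same =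
    separates (other-≢ u) (proper e s e' s' inside inside' h≢h' same) (notColour h inside notU) (notColour h' inside' notU')
    where
    inside : Inside G Y e
    inside = uncut⇒Inside {Y} h Yv uncut
    inside' : Inside G Y e'
    inside' = uncut⇒Inside {Y} h' (trans (cong Y (sym same)) Yv) uncut'
    notColour : ∀ (h : HalfEdge G) → Inside G Y (edge h) → colourClass Y φ u (edge h) ≡ false → φ (edge h) ≢ u
    notColour (e , _) (Ye₀ , Ye₁) notU φe≡u =
      contradiction (trans (sym (cong₂ _∧_ (cong₂ _∧_ Ye₀ Ye₁) (trans (cong (λ c → does (c ≟ᶠ u)) φe≡u) (dec-true (u ≟ᶠ u) refl)))) notU) λ ()

  uncut-side : ∀ {X} (h : HalfEdge G) → δ G X (edge h) ≡ false → X (ends G (edge h) zero) ≡ X (end h)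
  uncut-side (e , zero)     _     = refl
  uncut-side {X} (e , suc zero) uncut with X (ends G e zero) | X (ends G e (suc zero))
  ... | true  | true  = refl
  ... | false | false = refl
  ... | true  | false = contradiction uncut λ ()
  ... | false | true  = contradiction uncut λ ()

  twoSided-alternating : ∀ {X φ₁ φ₂ u₁ u₂} → ProperOn X φ₁ → ProperOn (complement G X) φ₂ →
    Alternating (λ e → not (colourClass X φ₁ u₁ e ∨ colourClass (complement G X) φ₂ u₂ e) ∧ not (δ G X e))
                (λ e → if X (ends G e zero) then does (φ₁ e ≟ᶠ other u₁) else does (φ₂ e ≟ᶠ other u₂))
  twoSided-alternating {X} {φ₁} {φ₂} {u₁} {u₂} proper₁ proper₂ h h' Sh Sh' h≢h' same eq =
    bySide (X (end h)) refl (outside h Sh) (outside h' Sh')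
    where
    β₁ β₂ : Fin (m G) → Bool
    β₁ e = does (φ₁ e ≟ᶠ other u₁)
    β₂ e = does (φ₂ e ≟ᶠ other u₂)
    Outside : HalfEdge G → Set
    Outside h = colourClass X φ₁ u₁ (edge h) ≡ false × colourClass (complement G X) φ₂ u₂ (edge h) ≡ false × δ G X (edge h) ≡ false
    outside : ∀ h → not (colourClass X φ₁ u₁ (edge h) ∨ colourClass (complement G X) φ₂ u₂ (edge h)) ∧ not (δ G X (edge h)) ≡ true → Outside h
    outside h S with colourClass X φ₁ u₁ (edge h) | colourClass (complement G X) φ₂ u₂ (edge h) | δ G X (edge h)
    ... | false | false | false = refl , refl , refl
    ... | true  | _     | _     = contradiction S λ ()
    ... | false | true  | _     = contradiction S λ ()
    ... | false | false | true  = contradiction S λ ()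
    branch : ∀ (h : HalfEdge G) {b} → δ G X (edge h) ≡ false → X (end h) ≡ b →
             (if X (ends G (edge h) zero) then β₁ (edge h) else β₂ (edge h)) ≡ (if b then β₁ (edge h) else β₂ (edge h))
    branch h uncut Xv = cong (λ x → if x then β₁ (edge h) else β₂ (edge h)) (trans (uncut-side {X} h uncut) Xv)
    δ-complement : ∀ e → δ G (complement G X) e ≡ δ G X e
    δ-complement e = xor-annihilates-not (X (ends G e zero)) (X (ends G e (suc zero)))
    bySide : ∀ b → X (end h) ≡ b → Outside h → Outside h' → ⊥
    bySide true Xv (notU₁ , _ , uncut) (notU₁' , _ , uncut') =
      side-alternating {X} {φ₁} {u₁} proper₁ h h' Xv uncut uncut' notU₁ notU₁' h≢h' same
        (trans (sym (branch h uncut Xv)) (trans eq (branch h' uncut' (trans (cong X (sym same)) Xv))))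
    bySide false Xv (_ , notU₂ , uncut) (_ , notU₂' , uncut') =
      side-alternating {complement G X} {φ₂} {u₂} proper₂ h h' (cong not Xv)
        (trans (δ-complement (edge h)) uncut) (trans (δ-complement (edge h')) uncut') notU₂ notU₂' h≢h' same
        (trans (sym (branch h uncut Xv)) (trans eq (branch h' uncut' (trans (cong X (sym same)) Xv))))

  -- Decomposition of a 2-regular edge set into circuits

  halfEdges : List (HalfEdge G)
  halfEdges = cartesianProduct (allFin (m G)) (allFin 2)

  sum-halfEdges : ∀ (g : HalfEdge G → ℕ) → List.sum (map g halfEdges) ≡ Σ[ m G ] (λ e → g (e , zero) + g (e , suc zero))
  sum-halfEdges g = go (allFin (m G))
    where
    go : ∀ es → List.sum (map g (cartesianProduct es (allFin 2))) ≡ List.sum (map (λ e → g (e , zero) + g (e , suc zero)) es)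
    go []       = refl
    go (e ∷ es) = trans (sym (+-assoc (g (e , zero)) _ _)) (cong (g (e , zero) + g (e , suc zero) +_) (go es))

  _≟ₕ_ : (h h' : HalfEdge G) → Dec (h ≡ h')
  _≟ₕ_ = ≡-dec _≟ᶠ_ _≟ᶠ_

  AtVertex : (Fin (m G) → Bool) → Fin (n G) → HalfEdge G → Set
  AtVertex F v h = F (edge h) ≡ true × end h ≡ v

  atVertex? : ∀ F v → Decidable (AtVertex F v)
  atVertex? F v h = (F (edge h) Bool.≟ true) ×-dec (end h ≟ᶠ v)

  halfEdgesAt : (Fin (m G) → Bool) → Fin (n G) → List (HalfEdge G)
  halfEdgesAt F v = filter (atVertex? F v) halfEdges

  ∑-halfEdgesAt : ∀ F v (g : HalfEdge G → ℕ) →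
    List.sum (map g (halfEdgesAt F v)) ≡ Σ[ m G ] (λ e → ⟦ F e ⟧ * ([ ends G e zero ≟ v ] * g (e , zero) + [ ends G e (suc zero) ≟ v ] * g (e , suc zero)))
  ∑-halfEdgesAt F v g = trans (sum-filter _ g halfEdges) (trans (sum-halfEdges _) (cong List.sum (map-cong pointwise (allFin (m G)))))
    where
    pointwise : ∀ e → ⟦ does ((F e Bool.≟ true) ×-dec (ends G e zero ≟ᶠ v)) ⟧ * g (e , zero) + ⟦ does ((F e Bool.≟ true) ×-dec (ends G e (suc zero) ≟ᶠ v)) ⟧ * g (e , suc zero)
                    ≡ ⟦ F e ⟧ * ([ ends G e zero ≟ v ] * g (e , zero) + [ ends G e (suc zero) ≟ v ] * g (e , suc zero))
    pointwise e with F e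
    ... | true  = sym (+-identityʳ _)
    ... | false = refl

  length-halfEdgesAt : ∀ F v → length (halfEdgesAt F v) ≡ degIn G F v
  length-halfEdgesAt F v = trans (length≡sum (halfEdgesAt F v)) (trans (∑-halfEdgesAt F v (λ _ → 1)) (cong List.sum (map-cong (λ e → cong (⟦ F e ⟧ *_) (cong₂ _+_ (*-identityʳ [ ends G e zero ≟ v ]) (*-identityʳ [ ends G e (suc zero) ≟ v ]))) (allFin (m G)))))

  degIn-∧ : ∀ (F P : Fin (m G) → Bool) v → degIn G (λ e → F e ∧ P e) v ≡ List.sum (map (λ h → ⟦ P (edge h) ⟧) (halfEdgesAt F v))
  degIn-∧ F P v = sym (trans (∑-halfEdgesAt F v (λ h → ⟦ P (edge h) ⟧)) (cong List.sum (map-cong pointwise (allFin (m G)))))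
    where
    pointwise : ∀ e → ⟦ F e ⟧ * ([ ends G e zero ≟ v ] * ⟦ P e ⟧ + [ ends G e (suc zero) ≟ v ] * ⟦ P e ⟧)
                      ≡ ⟦ F e ∧ P e ⟧ * ([ ends G e zero ≟ v ] + [ ends G e (suc zero) ≟ v ])
    pointwise e with F e | P e
    ... | false | _     = refl
    ... | true  | true  = cong (_+ 0) (cong₂ _+_ (*-identityʳ [ ends G e zero ≟ v ]) (*-identityʳ [ ends G e (suc zero) ≟ v ]))
    ... | true  | false = trans (+-identityʳ _) (cong₂ _+_ (*-zeroʳ [ ends G e zero ≟ v ]) (*-zeroʳ [ ends G e (suc zero) ≟ v ]))

  ∈-halfEdgesAt⁺ : ∀ {F v} (h : HalfEdge G) → F (edge h) ≡ true → end h ≡ v → h ∈ halfEdgesAt F v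
  ∈-halfEdgesAt⁺ {F} {v} (e , s) Fe end≡v = ∈-filter⁺ (atVertex? F v) (∈-cartesianProduct⁺ (∈-allFin e) (∈-allFin s)) (Fe , end≡v)

  ∈-halfEdgesAt⁻ : ∀ {F v} {h : HalfEdge G} → h ∈ halfEdgesAt F v → F (edge h) ≡ true × end h ≡ v
  ∈-halfEdgesAt⁻ {F} {v} h∈ = proj₂ (∈-filter⁻ (atVertex? F v) {xs = halfEdges} h∈)

  halfEdgesAt-unique : ∀ F v → Unique (halfEdgesAt F v)
  halfEdgesAt-unique F v = filter⁺ (atVertex? F v) (cartesianProduct⁺ (allFin⁺ (m G)) (allFin⁺ 2))

  swapIn : List (HalfEdge G) → HalfEdge G → HalfEdge G
  swapIn (a ∷ b ∷ []) h = if does (h ≟ₕ a) then b else a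
  swapIn _            h = h

  swapIn-pair : ∀ {a b x} → a ≢ b → x ∈ a ∷ b ∷ [] →
                (x ≡ a × swapIn (a ∷ b ∷ []) x ≡ b) ⊎ (x ≡ b × swapIn (a ∷ b ∷ []) x ≡ a)
  swapIn-pair {a} a≢b (here refl)         = inj₁ (refl , cong (if_then _ else a) (dec-true (a ≟ₕ a) refl))
  swapIn-pair {a} {b} a≢b (there (here refl)) = inj₂ (refl , cong (if_then b else a) (dec-false (b ≟ₕ a) (a≢b ∘ sym)))

  opp : HalfEdge G → HalfEdge G
  opp (e , zero)     = e , suc zero
  opp (e , suc zero) = e , zero

  opp-involutive : ∀ h → opp (opp h) ≡ h
  opp-involutive (e , zero)     = refl
  opp-involutive (e , suc zero) = refl

  opp-≢ : ∀ h → opp h ≢ h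
  opp-≢ (e , zero)     ()
  opp-≢ (e , suc zero) ()

  sameEdge : ∀ (h h' : HalfEdge G) → edge h ≡ edge h' → h' ≡ h ⊎ h' ≡ opp h
  sameEdge (e , zero)     (.e , zero)     refl = inj₁ refl
  sameEdge (e , zero)     (.e , suc zero) refl = inj₂ refl
  sameEdge (e , suc zero) (.e , zero)     refl = inj₂ refl
  sameEdge (e , suc zero) (.e , suc zero) refl = inj₁ refl

  encode-injective : ∀ (h h' : HalfEdge G) → combine (edge h) (proj₂ h) ≡ combine (edge h') (proj₂ h') → h ≡ h'
  encode-injective (e , s) (e' , s') eq = trans (sym (remQuot-combine e s)) (trans (cong (remQuot 2) eq) (remQuot-combine e' s'))

  inCircuit : Circuit G → Fin (m G) → Bool
  inCircuit c e = does (any? λ i → es c i ≟ᶠ e)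

  occ≡inCircuit : ∀ c e → occ G c e ≡ ⟦ inCircuit c e ⟧
  occ≡inCircuit c e = count (any? λ i → es c i ≟ᶠ e)
    where
    count : (found : Dec (∃ λ i → es c i ≡ e)) → occ G c e ≡ ⟦ does found ⟧
    count (yes (i , refl)) = ≤-antisym occ≤1 (occ-es c i)
      where
      occ≤1 : occ G c (es c i) ≤ 1
      occ≤1 = subst (_≤ 1) (sym (Σ≡∑ (suc (len c)) _))
                (∑-atMostOne (λ j → [ es c j ≟ es c i ]) (λ j → ⟦⟧≤1 _)
                   λ j k p q → es-inj c (trans ([≟]-sound p) (sym ([≟]-sound q))))
    count (no none) = trans (Σ≡∑ (suc (len c)) _) (trans (sum-cong-≗ λ i → [≟]≡0 λ es≡e → none (i , es≡e)) (∑-const0 (suc (len c))))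

  module Partner (F : Fin (m G) → Bool) (degree0or2 : ∀ v → ZeroOrTwo (degIn G F v)) where

    partner : HalfEdge G → HalfEdge G
    partner h = swapIn (halfEdgesAt F (end h)) h

    pairAt : ∀ h → F (edge h) ≡ true → ∃₂ λ a b → halfEdgesAt F (end h) ≡ a ∷ b ∷ [] × a ≢ b
    pairAt h Fh with halfEdgesAt F (end h) in list≡ | length-halfEdgesAt F (end h) | degree0or2 (end h) | ∈-halfEdgesAt⁺ {F} h Fh refl
    ... | a ∷ b ∷ []    | _       | _       | _ with subst Unique list≡ (halfEdgesAt-unique F (end h))
    ...   | (a≢b ∷ []) ∷ _ = a , b , refl , a≢b
    pairAt h Fh | []            | _       | _       | ()
    pairAt h Fh | _ ∷ []        | length≡ | inj₁ d0 | _ = contradiction (trans length≡ d0) λ ()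
    pairAt h Fh | _ ∷ []        | length≡ | inj₂ d2 | _ = contradiction (trans length≡ d2) λ ()
    pairAt h Fh | _ ∷ _ ∷ _ ∷ _ | length≡ | inj₁ d0 | _ = contradiction (trans length≡ d0) λ ()
    pairAt h Fh | _ ∷ _ ∷ _ ∷ _ | length≡ | inj₂ d2 | _ = contradiction (trans length≡ d2) λ ()

    partner-view : ∀ h → F (edge h) ≡ true → ∃₂ λ a b → halfEdgesAt F (end h) ≡ a ∷ b ∷ [] × a ≢ b ×
                     ((h ≡ a × partner h ≡ b) ⊎ (h ≡ b × partner h ≡ a))
    partner-view h Fh with pairAt h Fh
    ... | a , b , list≡ , a≢b =
      a , b , list≡ , a≢b ,
      subst (λ L → (h ≡ a × swapIn L h ≡ b) ⊎ (h ≡ b × swapIn L h ≡ a)) (sym list≡)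
            (swapIn-pair a≢b (subst (h ∈_) list≡ (∈-halfEdgesAt⁺ h Fh refl)))

    partner-at : ∀ h → F (edge h) ≡ true → F (edge (partner h)) ≡ true × end (partner h) ≡ end h
    partner-at h Fh with partner-view h Fh
    ... | a , b , list≡ , _ , inj₁ (_ , p≡b) = ∈-halfEdgesAt⁻ (subst (partner h ∈_) (sym list≡) (subst (_∈ a ∷ b ∷ []) (sym p≡b) (there (here refl))))
    ... | a , b , list≡ , _ , inj₂ (_ , p≡a) = ∈-halfEdgesAt⁻ (subst (partner h ∈_) (sym list≡) (subst (_∈ a ∷ b ∷ []) (sym p≡a) (here refl)))

    partner-≢ : ∀ h → F (edge h) ≡ true → partner h ≢ h
    partner-≢ h Fh with partner-view h Fh
    ... | _ , _ , _ , a≢b , inj₁ (h≡a , p≡b) = λ p≡h → a≢b (trans (sym h≡a) (trans (sym p≡h) p≡b))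
    ... | _ , _ , _ , a≢b , inj₂ (h≡b , p≡a) = λ p≡h → a≢b (trans (sym p≡a) (trans p≡h h≡b))

    partner-involutive : ∀ h → F (edge h) ≡ true → partner (partner h) ≡ h
    partner-involutive h Fh with partner-view h Fh
    ... | a , b , list≡ , a≢b , inj₁ (h≡a , p≡b) =
      trans (cong (λ L → swapIn L (partner h)) (trans (cong (halfEdgesAt F) (proj₂ (partner-at h Fh))) list≡))
            (trans (cong (swapIn (a ∷ b ∷ [])) p≡b) (trans (cong (if_then b else a) (dec-false (b ≟ₕ a) (a≢b ∘ sym))) (sym h≡a)))
    ... | a , b , list≡ , a≢b , inj₂ (h≡b , p≡a) =
      trans (cong (λ L → swapIn L (partner h)) (trans (cong (halfEdgesAt F) (proj₂ (partner-at h Fh))) list≡))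
            (trans (cong (swapIn (a ∷ b ∷ [])) p≡a) (trans (cong (if_then b else a) (dec-true (a ≟ₕ a) refl)) (sym h≡b)))

    partner-unique : ∀ h x → F (edge h) ≡ true → F (edge x) ≡ true → end x ≡ end h → x ≡ h ⊎ x ≡ partner h
    partner-unique h x Fh Fx same with partner-view h Fh
    ... | a , b , list≡ , _ , view = decide view (subst (x ∈_) list≡ (∈-halfEdgesAt⁺ {F} x Fx same))
      where
      decide : (h ≡ a × partner h ≡ b) ⊎ (h ≡ b × partner h ≡ a) → x ∈ a ∷ b ∷ [] → x ≡ h ⊎ x ≡ partner h
      decide (inj₁ (h≡a , p≡b)) (here x≡a)         = inj₁ (trans x≡a (sym h≡a))
      decide (inj₁ (h≡a , p≡b)) (there (here x≡b)) = inj₂ (trans x≡b (sym p≡b))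
      decide (inj₂ (h≡b , p≡a)) (here x≡a)         = inj₂ (trans x≡a (sym p≡a))
      decide (inj₂ (h≡b , p≡a)) (there (here x≡b)) = inj₁ (trans x≡b (sym h≡b))

    advance : HalfEdge G → HalfEdge G
    advance h = partner (opp h)

    edge-opp : ∀ h → edge (opp h) ≡ edge h
    edge-opp (e , zero)     = refl
    edge-opp (e , suc zero) = refl

    opp-F : ∀ h → F (edge h) ≡ true → F (edge (opp h)) ≡ true
    opp-F h = subst (λ e → F e ≡ true) (sym (edge-opp h))

    advance-F : ∀ h → F (edge h) ≡ true → F (edge (advance h)) ≡ true
    advance-F h Fh = proj₁ (partner-at (opp h) (opp-F h Fh))

    advance-injective : ∀ x y → F (edge x) ≡ true → F (edge y) ≡ true → advance x ≡ advance y → x ≡ y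
    advance-injective x y Fx Fy eq = trans (sym (opp-involutive x)) (trans (cong opp opp≡) (opp-involutive y))
      where
      opp≡ : opp x ≡ opp y
      opp≡ = trans (sym (partner-involutive (opp x) (opp-F x Fx))) (trans (cong partner eq) (partner-involutive (opp y) (opp-F y Fy)))

    advance^ : ℕ → HalfEdge G → HalfEdge G
    advance^ zero    h = h
    advance^ (suc t) h = advance (advance^ t h)

    advance^-F : ∀ t h → F (edge h) ≡ true → F (edge (advance^ t h)) ≡ true
    advance^-F zero    h Fh = Fh
    advance^-F (suc t) h Fh = advance-F _ (advance^-F t h Fh)

    advance^-+ : ∀ a b h → advance^ (a + b) h ≡ advance^ a (advance^ b h)
    advance^-+ zero    b h = refl
    advance^-+ (suc a) b h = cong advance (advance^-+ a b h)

    advance^-cancel : ∀ a d h → F (edge h) ≡ true → advance^ (a + d) h ≡ advance^ a h → advance^ d h ≡ h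
    advance^-cancel zero    d h Fh eq = eq
    advance^-cancel (suc a) d h Fh eq =
      advance^-cancel a d h Fh (advance-injective _ _ (advance^-F (a + d) h Fh) (advance^-F a h Fh) eq)

    advance^-≢opp : ∀ t h → F (edge h) ≡ true → advance^ t h ≢ opp h
    advance^-≢opp zero          h Fh eq = opp-≢ h (sym eq)
    advance^-≢opp (suc zero)    h Fh eq = partner-≢ (opp h) (opp-F h Fh) eq
    advance^-≢opp (suc (suc t)) h Fh eq = advance^-≢opp t (advance h) (advance-F h Fh) (trans (advance^-comm t h) back)
      where
      advance^-comm : ∀ t h → advance^ t (advance h) ≡ advance (advance^ t h)
      advance^-comm zero    h = refl
      advance^-comm (suc t) h = cong advance (advance^-comm t h)
      back : advance (advance^ t h) ≡ opp (advance h)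
      back = advance-injective _ _ (advance^-F (suc t) h Fh) (opp-F (advance h) (advance-F h Fh))
               (trans eq (sym (trans (cong partner (opp-involutive (advance h))) (partner-involutive (opp h) (opp-F h Fh)))))

    module Orbit (h₀ : HalfEdge G) (Fh₀ : F (edge h₀) ≡ true) where

      walk : ℕ → HalfEdge G
      walk t = advance^ t h₀

      walk-F : ∀ t → F (edge (walk t)) ≡ true
      walk-F t = advance^-F t h₀ Fh₀

      periodic : ∃ λ q → walk (suc q) ≡ h₀
      periodic with pigeonhole (n<1+n (m G * 2)) (λ (i : Fin (suc (m G * 2))) → combine (edge (walk (toℕ i))) (proj₂ (walk (toℕ i))))
      ... | i , j , i<j , code≡ with m≤n⇒∃[o]m+o≡n i<j
      ...   | q , i+q≡j = q , advance^-cancel (toℕ i) (suc q) h₀ Fh₀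
                                (trans (cong walk (trans (+-suc (toℕ i) q) i+q≡j)) (sym (encode-injective _ _ code≡)))

      period : ∃ λ p → walk (suc p) ≡ h₀ × (∀ q → q < p → walk (suc q) ≢ h₀)
      period = least-witness (λ q → walk (suc q) ≟ₕ h₀) (proj₁ periodic) (proj₂ periodic)

      module Cycle (p : ℕ) (returns : walk (suc p) ≡ h₀) (minimal : ∀ q → q < p → walk (suc q) ≢ h₀) where

        split< : ∀ {a b} → a < b → ∃ λ q → a + suc q ≡ b
        split< {a} a<b = let q , eq = m≤n⇒∃[o]m+o≡n a<b in q , trans (+-suc a q) eq

        walk-injective : ∀ a b → a < b → b ≤ p → walk a ≢ walk b
        walk-injective a b a<b b≤p eq with split< a<b
        ... | q , refl = minimal q (≤-trans (s≤s (m≤n+m q a)) (subst (_≤ p) (+-suc a q) b≤p))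
                                   (advance^-cancel a (suc q) h₀ Fh₀ (sym eq))

        walk-≢opp : ∀ a b → a ≤ b → walk b ≢ opp (walk a)
        walk-≢opp a b a≤b eq with m≤n⇒∃[o]m+o≡n a≤b
        ... | c , refl = advance^-≢opp c (walk a) (walk-F a) (trans (sym (advance^-+ c a h₀)) (trans (cong walk (+-comm c a)) eq))

        walk-edge-injective : ∀ a b → a < b → b ≤ p → edge (walk a) ≢ edge (walk b)
        walk-edge-injective a b a<b b≤p eq with sameEdge (walk a) (walk b) eq
        ... | inj₁ same = walk-injective a b a<b b≤p (sym same)
        ... | inj₂ opposite = walk-≢opp a b (<⇒≤ a<b) opposite

        -- A second visit to a vertex would have to arrive along the edge the walk left it by.
        walk-end-injective : ∀ a b → a < b → b ≤ p → end (walk a) ≢ end (walk b)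
        walk-end-injective a (suc b) a<b b≤p eq with partner-unique (walk a) (walk (suc b)) (walk-F a) (walk-F (suc b)) (sym eq)
        ... | inj₁ same = walk-injective a (suc b) a<b b≤p (sym same)
        ... | inj₂ partnered = walk-≢opp a b (s≤s⁻¹ a<b)
               (trans (sym (opp-involutive (walk b))) (cong opp (trans (sym (partner-involutive (opp (walk b)) (opp-F (walk b) (walk-F b))))
                                                                        (trans (cong partner partnered) (partner-involutive (walk a) (walk-F a))))))

        injective-on-period : (R : ℕ → ℕ → Set) → (∀ a b → a < b → b ≤ p → ¬ R a b) → (∀ {a b} → R a b → R b a) →
                              ∀ (i j : Fin (suc p)) → R (toℕ i) (toℕ j) → i ≡ j
        injective-on-period R never symmetric i j r with <-cmp (toℕ i) (toℕ j)
        ... | tri< i<j _ _ = contradiction r (never _ _ i<j (s≤s⁻¹ (toℕ<n j)))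
        ... | tri≈ _ i≡j _ = toℕ-injective i≡j
        ... | tri> _ _ j<i = contradiction (symmetric r) (never _ _ j<i (s≤s⁻¹ (toℕ<n i)))

        walk-next : ∀ (i : Fin (suc p)) → walk (toℕ (next G i)) ≡ advance (walk (toℕ i))
        walk-next i with m≤n⇒m<n∨m≡n (s≤s⁻¹ (toℕ<n i))
        ... | inj₁ i<p  = cong walk (trans (toℕ-fromℕ< _) (m<n⇒m%n≡m (s≤s i<p)))
        ... | inj₂ i≡p  = trans (cong walk (trans (toℕ-fromℕ< _) (trans (cong (λ t → suc t % suc p) i≡p) (n%n≡0 (suc p)))))
                                (trans (sym returns) (cong (advance ∘ walk) (sym i≡p)))

        joins-opp : ∀ (h : HalfEdge G) → Joins G (edge h) (end h) (end (opp h))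
        joins-opp (e , zero)     = inj₁ (refl , refl)
        joins-opp (e , suc zero) = inj₂ (refl , refl)

        cycle : Circuit G
        cycle = record
          { len    = p
          ; vs     = λ i → end (walk (toℕ i))
          ; es     = λ i → edge (walk (toℕ i))
          ; vs-inj = λ {i} {j} → injective-on-period (λ a b → end (walk a) ≡ end (walk b)) walk-end-injective sym i j
          ; es-inj = λ {i} {j} → injective-on-period (λ a b → edge (walk a) ≡ edge (walk b)) walk-edge-injective sym i j
          ; joins  = λ i → subst (Joins G _ _) (sym (trans (cong end (walk-next i)) (proj₂ (partner-at (opp (walk (toℕ i))) (opp-F (walk (toℕ i)) (walk-F (toℕ i)))))))
                                 (joins-opp (walk (toℕ i)))
          }

        walk-periodic : ∀ k → walk (k * suc p) ≡ h₀
        walk-periodic zero    = refl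
        walk-periodic (suc k) = trans (advance^-+ (suc p) (k * suc p) h₀) (trans (cong (advance^ (suc p)) (walk-periodic k)) returns)

        walk-inCycle : ∀ t → inCircuit cycle (edge (walk t)) ≡ true
        walk-inCycle t = dec-true (any? λ (i : Fin (suc p)) → edge (walk (toℕ i)) ≟ᶠ edge (walk t)) (fromℕ< (m%n<n t (suc p)) , cong edge reduce)
          where
          reduce : walk (toℕ (fromℕ< (m%n<n t (suc p)))) ≡ walk t
          reduce = begin
            walk (toℕ (fromℕ< (m%n<n t (suc p))))   ≡⟨ cong walk (toℕ-fromℕ< (m%n<n t (suc p))) ⟩
            walk (t % suc p)                         ≡⟨ cong (advance^ (t % suc p)) (sym (walk-periodic (t / suc p))) ⟩
            advance^ (t % suc p) (walk (t / suc p * suc p)) ≡⟨ sym (advance^-+ (t % suc p) (t / suc p * suc p) h₀) ⟩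
            walk (t % suc p + t / suc p * suc p)     ≡⟨ cong walk (sym (m≡m%n+[m/n]*n t (suc p))) ⟩
            walk t                                   ∎
            where open ≡-Reasoning

        inCycle-walk : ∀ e → inCircuit cycle e ≡ true → ∃ λ t → edge (walk t) ≡ e
        inCycle-walk e found = let i , eq = witness (any? λ (i : Fin (suc p)) → edge (walk (toℕ i)) ≟ᶠ e) found in toℕ i , eq

        inCycle-partner : ∀ x → F (edge x) ≡ true → inCircuit cycle (edge x) ≡ true → inCircuit cycle (edge (partner x)) ≡ true
        inCycle-partner x Fx found with inCycle-walk (edge x) found
        ... | t , eq with sameEdge (walk t) x eq
        ...   | inj₂ refl = walk-inCycle (suc t)
        ...   | inj₁ refl = subst (λ e → inCircuit cycle e ≡ true) (sym (trans (cong edge partner≡) (edge-opp (walk (t + p))))) (walk-inCycle (t + p))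
          where
          arrive : walk t ≡ advance (walk (t + p))
          arrive = sym (trans (cong walk (sym (+-suc t p))) (trans (advance^-+ t (suc p) h₀) (cong (advance^ t) returns)))
          partner≡ : partner (walk t) ≡ opp (walk (t + p))
          partner≡ = trans (cong partner arrive) (partner-involutive (opp (walk (t + p))) (opp-F (walk (t + p)) (walk-F (t + p))))

        inCycle⇒F : ∀ e → inCircuit cycle e ≡ true → F e ≡ true
        inCycle⇒F e found with inCycle-walk e found
        ... | t , refl = walk-F t

        rest : Fin (m G) → Bool
        rest e = F e ∧ not (inCircuit cycle e)

        rest-degree : ∀ v → ZeroOrTwo (degIn G rest v)
        rest-degree v = subst ZeroOrTwo (sym (degIn-∧ F (not ∘ inCircuit cycle) v)) (bySum (halfEdgesAt F v) refl)
          where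
          Sum : List (HalfEdge G) → ℕ
          Sum L = List.sum (map (λ h → ⟦ not (inCircuit cycle (edge h)) ⟧) L)
          wrongLength : ∀ {L} → halfEdgesAt F v ≡ L → length L ≢ 0 → length L ≢ 2 → ⊥
          wrongLength list≡ ≢0 ≢2 = [ ≢0 ∘ trans length≡ , ≢2 ∘ trans length≡ ]′ (degree0or2 v)
            where length≡ = trans (cong length (sym list≡)) (length-halfEdgesAt F v)
          twice : ∀ b → ZeroOrTwo (⟦ not b ⟧ + (⟦ not b ⟧ + 0))
          twice true  = inj₁ refl
          twice false = inj₂ refl
          bySum : ∀ L → halfEdgesAt F v ≡ L → ZeroOrTwo (Sum L)
          bySum []              _     = inj₁ refl
          bySum (_ ∷ [])        list≡ = ⊥-elim (wrongLength list≡ (λ ()) (λ ()))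
          bySum (_ ∷ _ ∷ _ ∷ _) list≡ = ⊥-elim (wrongLength list≡ (λ ()) (λ ()))
          bySum (a ∷ b ∷ [])    list≡ with subst Unique list≡ (halfEdgesAt-unique F v)
          ... | (a≢b ∷ []) ∷ _ with ∈-halfEdgesAt⁻ {F} (subst (a ∈_) (sym list≡) (here refl))
                                  | ∈-halfEdgesAt⁻ {F} (subst (b ∈_) (sym list≡) (there (here refl)))
          ...   | Fa , a-at | Fb , b-at with partner-unique a b Fa Fb (trans b-at (sym a-at))
          ...     | inj₁ b≡a = contradiction (sym b≡a) a≢b
          ...     | inj₂ refl = subst (λ x → ZeroOrTwo (⟦ not (inCircuit cycle (edge a)) ⟧ + (⟦ not x ⟧ + 0))) sameSide (twice (inCircuit cycle (edge a)))
            where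
            sameSide : inCircuit cycle (edge a) ≡ inCircuit cycle (edge (partner a))
            sameSide = ⇔→≡ {z = true} (mk⇔ (inCycle-partner a Fa)
                         (λ found → subst (λ h → inCircuit cycle (edge h) ≡ true) (partner-involutive a Fa) (inCycle-partner (partner a) Fb found)))

        rest-smaller : edgeCount rest < edgeCount F
        rest-smaller = ∑-mono-< (λ e → ∧-≤ (F e) _) (edge h₀) (subst (λ b → ⟦ F (edge h₀) ∧ not b ⟧ < ⟦ F (edge h₀) ⟧) (sym (walk-inCycle 0))
                                                         (subst (λ b → ⟦ b ∧ false ⟧ < ⟦ b ⟧) (sym Fh₀) (s≤s z≤n)))
          where
          ∧-≤ : ∀ a b → ⟦ a ∧ b ⟧ ≤ ⟦ a ⟧
          ∧-≤ true  b = ⟦⟧≤1 b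
          ∧-≤ false b = z≤n

        cycle+rest : ∀ e → occ G cycle e + ⟦ rest e ⟧ ≡ ⟦ F e ⟧
        cycle+rest e = trans (cong (_+ ⟦ rest e ⟧) (occ≡inCircuit cycle e)) (split (inCircuit cycle e) (F e) (inCycle⇒F e))
          where
          split : ∀ c f → (c ≡ true → f ≡ true) → ⟦ c ⟧ + ⟦ f ∧ not c ⟧ ≡ ⟦ f ⟧
          split true  true  _   = refl
          split true  false c⇒f = contradiction (c⇒f refl) λ ()
          split false true  _   = refl
          split false false _   = refl

  circuitDecomposition : ∀ bound F → edgeCount F ≤ bound → (∀ v → ZeroOrTwo (degIn G F v)) →
                         Σ (List (Circuit G)) (CircuitsOf G F)
  circuitDecomposition bound F size≤ degree0or2 with any? (λ e → F e Bool.≟ true)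
  ... | no noEdge = [] , λ e → cong ⟦_⟧ (sym (¬-not λ Fe → noEdge (e , Fe)))
  circuitDecomposition zero F size≤ _ | yes (e₀ , Fe₀) =
    contradiction (≤-trans (subst (λ b → 1 ≤ ⟦ b ⟧) (sym Fe₀) ≤-refl) (∑-single (λ e → ⟦ F e ⟧) e₀)) (<⇒≱ (s≤s size≤))
  circuitDecomposition (suc bound) F size≤ degree0or2 | yes (e₀ , Fe₀) =
    let cs , decomposition = circuitDecomposition bound rest (s≤s⁻¹ (≤-trans rest-smaller size≤)) rest-degree
    in cycle ∷ cs , λ e → trans (cong (occ G cycle e +_) (decomposition e)) (cycle+rest e)
    where
    open Partner F degree0or2
    open Orbit (e₀ , zero) Fe₀
    open Cycle (proj₁ period) (proj₁ (proj₂ period)) (proj₂ (proj₂ period))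

  cutSize-complement : ∀ X → cutSize G (complement G X) ≡ cutSize G X
  cutSize-complement X = trans (Σ≡∑ (m G) _) (trans (sum-cong-≗ λ e → cong ⟦_⟧ (xor-annihilates-not (X (ends G e zero)) (X (ends G e (suc zero)))))
                                                     (sym (Σ≡∑ (m G) _)))

  oddness≤2 : ∀ {X φ₁ φ₂ u₁ u₂} → Cubic G → cutSize G X ≡ 4 → ProperOn X φ₁ → ProperOn (complement G X) φ₂ →
              (∀ v → X v ≡ true → degIn G (colourClass X φ₁ u₁) v ≡ 1) →
              (∀ v → not (X v) ≡ true → degIn G (colourClass (complement G X) φ₂ u₂) v ≡ 1) →
              OddnessAtMost G 2
  oddness≤2 {X} {φ₁} {φ₂} {u₁} {u₂} cubic cut≡4 proper₁ proper₂ cover₁ cover₂ =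
    let cs , decomposition = circuitDecomposition (edgeCount F) F ≤-refl (λ v → inj₂ (twoFactor v))
    in F , twoFactor , cs , decomposition ,
       *-cancelˡ-≤ 2 (≤-trans (oddCircuits-bound {F} {X} (twoSided-alternating {X} {φ₁} {φ₂} {u₁} {u₂} proper₁ proper₂) cs decomposition) (≤-reflexive cut≡4))
    where
    M F : Fin (m G) → Bool
    M e = colourClass X φ₁ u₁ e ∨ colourClass (complement G X) φ₂ u₂ e
    F = not ∘ M
    twoFactor : TwoFactor G F
    twoFactor = complement-perfectMatching {M} cubic
                  (perfectMatching-∨ {X} (λ e → colourClass⇒Inside {X} {φ₁} {u₁} {e}) (λ e → colourClass⇒Inside {complement G X} {φ₂} {u₂} {e})
                     cover₁ (λ v Xv → cover₂ v (cong not Xv)))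

proposition3p4 : (G : Graph) → Cubic G → (X : Fin (n G) → Bool) →
    cutSize G X ≡ 4 →
    ConnectedOn G X → ConnectedOn G (complement G X) →
    HasCircuitIn G X → HasCircuitIn G (complement G X) →
    ThreeColourableOn G X → ThreeColourableOn G (complement G X) →
    OddnessAtMost G 2
proposition3p4 G cubic X cut≡4 _ _ _ _ (φ₁ , proper₁) (φ₂ , proper₂) =
  let u₁ , cover₁ = perfectColourClass {G} {X} {φ₁} cubic cut≡4 proper₁
      u₂ , cover₂ = perfectColourClass {G} {complement G X} {φ₂} cubic (trans (cutSize-complement {G} X) cut≡4) proper₂
  in oddness≤2 {G} {X} {φ₁} {φ₂} {u₁} {u₂} cubic cut≡4 proper₁ proper₂ cover₁ cover₂
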